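{- Let $G=(V,E)$ be a directed acyclic graph with exactly one source and one sink, with topological ordering $\textit{ordD}$ and the arrays and subroutine ValidateSuperBubble defined in the context. Let $s$ be an entrance candidate and $e,e'$ exit candidates with $\textit{ordD}[s]<\textit{ordD}[e']<\textit{ordD}[e]$. Suppose ValidateSuperBubble$(s,e)$ returns a vertex $t$ and ValidateSuperBubble$(s,e')$ returns a vertex $t'$ (i.e. neither returns $-1$ or NULL). Then $\textit{ordD}[t]\le \textit{ordD}[t']$.
   Context: $\textit{ordD}:V\to\{1,\dots,n\}$ is a topological ordering of $G$ ($\textit{ordD}[x]<\textit{ordD}[y]$ for all edges $(x,y)$), $n=|V|$; for an integer $i$, Vertex$(i)$ denotes the vertex $v$ with $\textit{ordD}[v]=i$. A vertex is an entrance candidate if it has at least one child whose in-degree is $1$, and an exit candidate if it has at least one parent whose out-degree is $1$. For each vertex $v$, $\textit{previousEntrance}[v]$ is the entrance candidate $s$ with the largest $\textit{ordD}[s]$ subject to $\textit{ordD}[s]<\textit{ordD}[v]$ (NULL if none). For each vertex $v$, $\textit{OutParent}[\textit{ordD}[v]]=\min\{\textit{ordD}[u]:(u,v)\in E\}$ and $\textit{OutChild}[\textit{ordD}[v]]=\max\{\textit{ordD}[u]:(v,u)\in E\}$. ValidateSuperBubble$(a,b)$: let $\textit{start}=\textit{ordD}[a]$, $\textit{end}=\textit{ordD}[b]$, $\textit{outchild}=\max \textit{OutChild}[\textit{start}..\textit{end}-1]$, $\textit{outparent}=\min\textit{OutParent}[\textit{start}+1..\textit{end}]$. If $\textit{outchild}\ne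 \textit{end}$, return $-1$; else if $\textit{outparent}=\textit{start}$, return $a$; else if Vertex$(\textit{outparent})$ is an entrance candidate, return Vertex$(\textit{outparent})$; else return $\textit{previousEntrance}[\text{Vertex}(\textit{outparent})]$. -}

module Defs where

open import Data.Bool using (Bool; true; false; _∧_; if_then_else_; T)
open import Data.Nat using (ℕ; zero; suc; _<_; _≤_; _⊔_; _⊓_; _≡ᵇ_; _<ᵇ_; _≤ᵇ_; _<?_)
open import Data.Fin using (Fin; toℕ; fromℕ<)
open import Data.Fin.Permutation using (Permutation′; _⟨$⟩ʳ_; _⟨$⟩ˡ_)
open import Data.List using (List; []; _∷_; map; foldr; filterᵇ; length)
open import Data.Bool.ListAction using (any)
open import Data.List.Base using (allFin)
open import Data.Maybe using (Maybe; just; nothing)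
open import Data.Product using (Σ; _×_; ∃)
open import Relation.Binary.PropositionalEquality using (_≡_)
open import Relation.Nullary using (yes; no)

record Digraph : Set where
  field
    n : ℕ
    E : Fin n → Fin n → Bool
open Digraph public

module _ (G : Digraph) where
  private
    N = n G
    Ed = E G

  vertices : List (Fin N)
  vertices = allFin N

  parents : Fin N → List (Fin N)
  parents v = filterᵇ (λ u → Ed u v) vertices

  children : Fin N → List (Fin N)
  children v = filterᵇ (λ u → Ed v u) vertices

  inDegree : Fin N → ℕ
  inDegree v = length (parents v)

  outDegree : Fin N → ℕ
  outDegree v = length (children v)

  IsSource : Fin N → Set
  IsSource v = inDegree v ≡ 0

  IsSink : Fin N → Set
  IsSink v = outDegree v ≡ 0

  UniqueSourceSink : Set
  UniqueSourceSink =
    (Σ (Fin N) λ s → IsSource s × (∀ v → IsSource v → v ≡ s)) ×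
    (Σ (Fin N) λ t → IsSink t × (∀ v → IsSink v → v ≡ t))

  entranceᵇ : Fin N → Bool
  entranceᵇ v = any (λ c → inDegree c ≡ᵇ 1) (children v)

  exitᵇ : Fin N → Bool
  exitᵇ v = any (λ p → outDegree p ≡ᵇ 1) (parents v)

  EntranceCandidate : Fin N → Set
  EntranceCandidate v = T (entranceᵇ v)

  ExitCandidate : Fin N → Set
  ExitCandidate v = T (exitᵇ v)

  -- Topological orderings: a bijection V → {0,…,n-1} (0-based version of
  -- the paper's {1,…,n}) increasing along every edge.
  module Ordering (ordD : Permutation′ N) where

    ord : Fin N → ℕ
    ord v = toℕ (ordD ⟨$⟩ʳ v)

    IsTopological : Set
    IsTopological = ∀ x y → T (Ed x y) → ord x < ord y

    Vertex : ℕ → Maybe (Fin N)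
    Vertex i with i <? N
    ... | yes p = just (ordD ⟨$⟩ˡ fromℕ< p)
    ... | no _  = nothing

    -- OutParent[ordD v] = min ordD of parents (N if v has no parent;
    -- this case never enters ValidateSuperBubble when G has a unique source)
    OutParent : Fin N → ℕ
    OutParent v = foldr _⊓_ N (map ord (parents v))

    OutChild : Fin N → ℕ
    OutChild v = foldr _⊔_ 0 (map ord (children v))

    pickMax : List (Fin N) → Maybe (Fin N)
    pickMax [] = nothing
    pickMax (x ∷ xs) with pickMax xs
    ... | nothing = just x
    ... | just y = if ord x <ᵇ ord y then just y else just x

    previousEntrance : Fin N → Maybe (Fin N)
    previousEntrance v =
      pickMax (filterᵇ (λ s → entranceᵇ s ∧ (ord s <ᵇ ord v)) vertices)

    rangeOutChild : ℕ → ℕ → ℕ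
    rangeOutChild start end =
      foldr _⊔_ 0 (map OutChild
        (filterᵇ (λ v → (start ≤ᵇ ord v) ∧ (ord v <ᵇ end)) vertices))

    rangeOutParent : ℕ → ℕ → ℕ
    rangeOutParent start end =
      foldr _⊓_ N (map OutParent
        (filterᵇ (λ v → (start <ᵇ ord v) ∧ (ord v ≤ᵇ end)) vertices))

    -- ValidateSuperBubble(a,b); nothing encodes the results -1 / NULL
    validateSuperBubble : Fin N → Fin N → Maybe (Fin N)
    validateSuperBubble a b =
      if outchild ≡ᵇ end then
        (if outparent ≡ᵇ start then just a else viaVertex (Vertex outparent))
      else nothing
      where
        start = ord a
        end = ord b
        outchild = rangeOutChild start end
        outparent = rangeOutParent start end
        viaVertex : Maybe (Fin N) → Maybe (Fin N)
        viaVertex nothing = nothing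
        viaVertex (just w) = if entranceᵇ w then just w else previousEntrance w

-- For an entrance candidate a, ValidateSuperBubble(a, b) returns the entrance
-- candidate of largest order not exceeding outparent(a, b), the minimum of
-- OutParent over (ord a, ord b]: either a itself (outparent = ord a),
-- Vertex(outparent), or the previous entrance candidate of Vertex(outparent).
-- Shrinking the range from e to e′ can only raise this minimum, so the last
-- entrance candidate below it can only move up.
module Submission where

open import Defs
open import Data.Bool using (Bool; true; false; T; _∧_; if_then_else_)
open import Data.Bool.Properties using (T-∧)
open import Data.Fin using (Fin; toℕ)
open import Data.Fin.Permutation using (Permutation′; _⟨$⟩ˡ_; inverseˡ; inverseʳ)
open import Data.Fin.Properties using (toℕ-fromℕ<; toℕ-injective)
open import Data.List using (List; []; _∷_; foldr)
open import Data.List.Membership.Propositional using (_∈_)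
open import Data.List.Membership.Propositional.Properties using (∈-filter⁺; ∈-filter⁻; ∈-allFin)
open import Data.List.Relation.Binary.Subset.Propositional using (_⊆_)
open import Data.List.Relation.Binary.Subset.Propositional.Properties using (map⁺; filter⁺′)
open import Data.List.Relation.Unary.All using (All; lookup; tabulate)
open import Data.List.Relation.Unary.Any using (here; there)
open import Data.List.Properties using (foldr-forcesᵇ; foldr-preservesᵇ)
open import Data.Maybe using (just; nothing)
open import Data.Maybe.Properties using (just-injective)
open import Data.Nat using (ℕ; _<_; _≤_; _⊓_; _≡ᵇ_; _<ᵇ_; _≤ᵇ_; _<?_)
open import Data.Nat.Properties
open import Data.Empty using (⊥-elim)
open import Data.Product using (_×_; _,_; proj₁; proj₂)
open import Data.Sum using (inj₁; inj₂)
open import Function using (_∘_; id)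
open import Function.Bundles using (Equivalence)
open import Relation.Binary.PropositionalEquality using (_≡_; refl; sym; trans; cong; subst)
open import Relation.Nullary using (¬_; yes; T?)

foldr-⊓≤xs : ∀ b (xs : List ℕ) → All (foldr _⊓_ b xs ≤_) xs
foldr-⊓≤xs b xs = foldr-forcesᵇ split b xs ≤-refl
  where
  split : ∀ {m} x y → m ≤ x ⊓ y → m ≤ x × m ≤ y
  split x y m≤x⊓y = ≤-trans m≤x⊓y (m⊓n≤m x y) , ≤-trans m≤x⊓y (m⊓n≤n x y)

foldr-⊓≤init : ∀ b (xs : List ℕ) → foldr _⊓_ b xs ≤ b
foldr-⊓≤init b []       = ≤-refl
foldr-⊓≤init b (x ∷ xs) = ≤-trans (m⊓n≤n x _) (foldr-⊓≤init b xs)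

foldr-⊓-antimono-⊆ : ∀ b {xs ys : List ℕ} → ys ⊆ xs → foldr _⊓_ b xs ≤ foldr _⊓_ b ys
foldr-⊓-antimono-⊆ b {xs} {ys} ys⊆xs =
  foldr-preservesᵇ ⊓-glb (foldr-⊓≤init b xs) (tabulate
    (λ y∈ys → lookup (foldr-⊓≤xs b xs) (ys⊆xs y∈ys)))

module _ (G : Digraph) (ordD : Permutation′ (n G)) where
  open Ordering G ordD

  ord-injective : ∀ {x y} → ord x ≡ ord y → x ≡ y
  ord-injective eq = trans (sym (inverseˡ ordD))
    (trans (cong (ordD ⟨$⟩ˡ_) (toℕ-injective eq)) (inverseˡ ordD))

  ord-Vertex : ∀ {i w} → Vertex i ≡ just w → ord w ≡ i
  ord-Vertex {i} eq with i <? n G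
  ord-Vertex refl | yes i<n = trans (cong toℕ (inverseʳ ordD)) (toℕ-fromℕ< i<n)

  rangeOutParent-antimono : ∀ start {end end′} → end′ ≤ end →
                            rangeOutParent start end ≤ rangeOutParent start end′
  rangeOutParent-antimono start {end} {end′} end′≤end =
    foldr-⊓-antimono-⊆ (n G) (map⁺ OutParent (filter⁺′ (T? ∘ inRange end′) (T? ∘ inRange end)
      widen {vertices G} id))
    where
    inRange : ℕ → Fin (n G) → Bool
    inRange bound v = (start <ᵇ ord v) ∧ (ord v ≤ᵇ bound)
    widen : ∀ {v} → T (inRange end′ v) → T (inRange end v)
    widen {v} p with Equivalence.to T-∧ p
    ... | s<v , v≤end′ = Equivalence.from T-∧
      (s<v , ≤⇒≤ᵇ (≤-trans (≤ᵇ⇒≤ (ord v) end′ v≤end′) end′≤end))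

  pickMax-nothing : ∀ xs → pickMax xs ≡ nothing → xs ≡ []
  pickMax-nothing []       _  = refl
  pickMax-nothing (x ∷ xs) eq with pickMax xs
  pickMax-nothing (x ∷ xs) () | nothing
  ... | just z with ord x <ᵇ ord z
  pickMax-nothing (x ∷ xs) () | just z | true
  pickMax-nothing (x ∷ xs) () | just z | false

  pickMax-∈ : ∀ xs {y} → pickMax xs ≡ just y → y ∈ xs
  pickMax-∈ (x ∷ xs) eq with pickMax xs in eq′
  ... | nothing = here (sym (just-injective eq))
  ... | just z with ord x <ᵇ ord z
  ...   | true  = there (pickMax-∈ xs (trans eq′ eq))
  ...   | false = here (sym (just-injective eq))

  pickMax-maximal : ∀ xs {x y} → pickMax xs ≡ just y → x ∈ xs → ord x ≤ ord y
  pickMax-maximal (w ∷ xs) eq x∈ with pickMax xs in eq′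
  pickMax-maximal (w ∷ xs) refl (here refl)  | nothing = ≤-refl
  pickMax-maximal (w ∷ xs) refl (there x∈xs) | nothing
    with () ← subst (_ ∈_) (pickMax-nothing xs eq′) x∈xs
  ... | just z with ord w <ᵇ ord z in w<z
  pickMax-maximal (w ∷ xs) refl (here refl)  | just z | true  =
    <⇒≤ (<ᵇ⇒< (ord w) (ord z) (subst T (sym w<z) _))
  pickMax-maximal (w ∷ xs) refl (there x∈xs) | just z | true  = pickMax-maximal xs eq′ x∈xs
  pickMax-maximal (w ∷ xs) refl (here refl)  | just z | false = ≤-refl
  pickMax-maximal (w ∷ xs) refl (there x∈xs) | just z | false =
    ≤-trans (pickMax-maximal xs eq′ x∈xs) (≮⇒≥ (λ w<z′ → subst T w<z (<⇒<ᵇ w<z′)))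

  record IsLastEntranceUpTo (p : ℕ) (t : Fin (n G)) : Set where
    field
      entrance : EntranceCandidate G t
      ord≤     : ord t ≤ p
      maximal  : ∀ {x} → EntranceCandidate G x → ord x ≤ p → ord x ≤ ord t

  lastEntrance-mono : ∀ {p p′ t t′} → p ≤ p′ →
                      IsLastEntranceUpTo p t → IsLastEntranceUpTo p′ t′ → ord t ≤ ord t′
  lastEntrance-mono p≤p′ last last′ =
    IsLastEntranceUpTo.maximal last′ (IsLastEntranceUpTo.entrance last)
      (≤-trans (IsLastEntranceUpTo.ord≤ last) p≤p′)

  previousEntrance-last : ∀ {w t} → ¬ EntranceCandidate G w → previousEntrance w ≡ just t →
                          IsLastEntranceUpTo (ord w) t
  previousEntrance-last {w} {t} w-not-entrance eq = record
    { entrance = proj₁ t-below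
    ; ord≤     = <⇒≤ t<w
    ; maximal  = maximal
    }
    where
    below : Fin (n G) → Bool
    below s = entranceᵇ G s ∧ (ord s <ᵇ ord w)

    t-below : EntranceCandidate G t × T (ord t <ᵇ ord w)
    t-below = Equivalence.to T-∧
      (proj₂ (∈-filter⁻ (T? ∘ below) {xs = vertices G} (pickMax-∈ _ eq)))

    t<w : ord t < ord w
    t<w = <ᵇ⇒< (ord t) (ord w) (proj₂ t-below)

    maximal : ∀ {x} → EntranceCandidate G x → ord x ≤ ord w → ord x ≤ ord t
    maximal {x} x-entrance x≤w with m≤n⇒m<n∨m≡n x≤w
    ... | inj₁ x<w = pickMax-maximal _ eq
      (∈-filter⁺ (T? ∘ below) (∈-allFin x) (Equivalence.from T-∧ (x-entrance , <⇒<ᵇ x<w)))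
    ... | inj₂ x≡w =
      ⊥-elim (w-not-entrance (subst (EntranceCandidate G) (ord-injective x≡w) x-entrance))

  isLastEntranceUpTo-ord : ∀ {t} → EntranceCandidate G t → IsLastEntranceUpTo (ord t) t
  isLastEntranceUpTo-ord t-entrance = record
    { entrance = t-entrance
    ; ord≤     = ≤-refl
    ; maximal  = λ _ x≤t → x≤t
    }

  viaVertex-last : ∀ {p w t} → Vertex p ≡ just w →
                (if entranceᵇ G w then just w else previousEntrance w) ≡ just t →
                IsLastEntranceUpTo p t
  viaVertex-last {w = w} vertex eq with entranceᵇ G w in w-entrance
  viaVertex-last vertex refl | true = subst (λ p → IsLastEntranceUpTo p _) (ord-Vertex vertex)
    (isLastEntranceUpTo-ord (subst T (sym w-entrance) _))
  viaVertex-last vertex eq   | false = subst (λ p → IsLastEntranceUpTo p _) (ord-Vertex vertex)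
    (previousEntrance-last (subst T w-entrance) eq)

  validateSuperBubble-last : ∀ {a b t} → EntranceCandidate G a → validateSuperBubble a b ≡ just t →
                             IsLastEntranceUpTo (rangeOutParent (ord a) (ord b)) t
  validateSuperBubble-last {a} {b} a-entrance eq
    with rangeOutChild (ord a) (ord b) ≡ᵇ ord b
       | rangeOutParent (ord a) (ord b) ≡ᵇ ord a in outparent≡start
       | Vertex (rangeOutParent (ord a) (ord b)) in vertex
  validateSuperBubble-last a-entrance refl | true | true | _ =
    subst (λ p → IsLastEntranceUpTo p _) (sym (≡ᵇ⇒≡ _ _ (subst T (sym outparent≡start) _)))
      (isLastEntranceUpTo-ord a-entrance)
  ... | true | false | just w = viaVertex-last vertex eq
  validateSuperBubble-last _ () | true  | false | nothing
  validateSuperBubble-last _ () | false | _     | _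

lemma5 : (G : Digraph) → UniqueSourceSink G →
         (ordD : Permutation′ (n G)) → Ordering.IsTopological G ordD →
         (s e e′ t t′ : Fin (n G)) →
         EntranceCandidate G s → ExitCandidate G e → ExitCandidate G e′ →
         Ordering.ord G ordD s < Ordering.ord G ordD e′ →
         Ordering.ord G ordD e′ < Ordering.ord G ordD e →
         Ordering.validateSuperBubble G ordD s e ≡ just t →
         Ordering.validateSuperBubble G ordD s e′ ≡ just t′ →
         Ordering.ord G ordD t ≤ Ordering.ord G ordD t′
lemma5 G _ ordD _ s e e′ t t′ s-entrance _ _ _ e′<e validate-e validate-e′ =
  lastEntrance-mono G ordD
    (rangeOutParent-antimono G ordD (ord s) (<⇒≤ e′<e))
    (validateSuperBubble-last G ordD s-entrance validate-e)
    (validateSuperBubble-last G ordD s-entrance validate-e′)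
  where open Ordering G ordD using (ord)
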